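{- For all integers $1\le k\le n$, $\sum_{j=k}^nL_{n,j}L_{j,k}=\delta_{nk}$.
   Context: $\mathbb{K}$ is a field of characteristic zero. Partial Bell polynomials: $B_{0,0}=1$, $B_{n,0}=0$ ($n\ge1$), $B_{n,k}=0$ ($k>n$), and for $1\le k\le n$, $B_{n,k}=\sum\frac{n!}{\prod_ir_i!(i!)^{r_i}}\prod_iX_i^{r_i}$ over non-negative integers with $\sum r_i=k$, $\sum ir_i=n$. $A_{n,k}\in\mathbb{K}[X_1^{ -1},X_1,X_2,\ldots]$ is the unique lower triangular family with $A_{0,0}=1$, $A_{n,0}=0$ ($n\ge1$) and $\sum_{j=k}^nA_{n,j}B_{j,k}=\delta_{nk}$. Signed Lah polynomials: $L_{n,k}:=\sum_{j=k}^n(-1)^jA_{n,j}B_{j,k}$. -}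

module Defs where

open import Level using (Level; _⊔_)
open import Data.Nat as ℕ using (ℕ; zero; suc; _!; _≡ᵇ_; NonZero)
open import Data.Nat.Properties using (_!≢0; m*n≢0; m^n≢0)
open import Data.Bool using (Bool; true; false; if_then_else_; _∧_)
open import Data.List using (List; []; _∷_; map; concatMap; upTo)
open import Data.Product using (Σ; _,_)
open import Relation.Nullary using (¬_)
open import Algebra.Bundles using (CommutativeRing)

private variable c ℓ : Level

tuples : (len bound : ℕ) → List (List ℕ)
tuples zero    bound = [] ∷ []
tuples (suc l) bound =
  concatMap (λ r → map (r ∷_) (tuples l bound)) (upTo (suc bound))

rsum : List ℕ → ℕ
rsum []       = 0
rsum (r ∷ rs) = r ℕ.+ rsum rs

wsum : ℕ → List ℕ → ℕ
wsum i []       = 0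
wsum i (r ∷ rs) = i ℕ.* r ℕ.+ wsum (suc i) rs

denom : ℕ → List ℕ → ℕ
denom i []       = 1
denom i (r ∷ rs) = (r ! ℕ.* ((i !) ℕ.^ r)) ℕ.* denom (suc i) rs

denom≢0 : ∀ i rs → NonZero (denom i rs)
denom≢0 i []       = _
denom≢0 i (r ∷ rs) =
  let instance
        _ = r !≢0
        _ = m^n≢0 (i !) r {{i !≢0}}
        _ = m*n≢0 (r !) ((i !) ℕ.^ r)
        _ = denom≢0 (suc i) rs
  in m*n≢0 (r ! ℕ.* ((i !) ℕ.^ r)) (denom (suc i) rs)

bellCoeff : ℕ → List ℕ → ℕ
bellCoeff n rs = ℕ._/_ (n !) (denom 1 rs) {{denom≢0 1 rs}}

module _ (R : CommutativeRing c ℓ) where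
  open CommutativeRing R

  nat : ℕ → Carrier
  nat zero    = 0#
  nat (suc n) = 1# + nat n

  pow : Carrier → ℕ → Carrier
  pow a zero    = 1#
  pow a (suc n) = a * pow a n

  sumL : List Carrier → Carrier
  sumL []       = 0#
  sumL (a ∷ as) = a + sumL as

  -- Σ_{j=k}^{n} f j   (empty, i.e. 0#, when n < k)
  sumFromTo : ℕ → ℕ → (ℕ → Carrier) → Carrier
  sumFromTo k n f = sumL (map (λ t → f (k ℕ.+ t)) (upTo (suc n ℕ.∸ k)))

  δ : ℕ → ℕ → Carrier
  δ n k = if n ≡ᵇ k then 1# else 0#

  sign : ℕ → Carrier
  sign j = pow (- 1#) j

  record IsField : Set (c ⊔ ℓ) where
    field
      1≉0     : ¬ (1# ≈ 0#)
      inverse : ∀ a → ¬ (a ≈ 0#) → Σ Carrier (λ b → a * b ≈ 1#)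

  CharZero : Set ℓ
  CharZero = ∀ n → ¬ (nat (suc n) ≈ 0#)

  module Bell (X : ℕ → Carrier) where

    mono : ℕ → List ℕ → Carrier
    mono i []       = 1#
    mono i (r ∷ rs) = pow (X i) r * mono (suc i) rs

    -- Partial Bell polynomial B_{n,k}(X_1, X_2, ...).
    -- For 1 ≤ k ≤ n the sum runs over (r_1,...,r_n) with Σ r_i = k,
    -- Σ i r_i = n (necessarily r_i = 0 for i > n and r_i ≤ n).
    B : ℕ → ℕ → Carrier
    B zero    zero    = 1#
    B (suc n) zero    = 0#
    B zero    (suc k) = 0#
    B (suc n) (suc k) =
      if suc n ℕ.<ᵇ suc k then 0#
      else sumL (map term (tuples (suc n) (suc n)))
      where
      term : List ℕ → Carrier
      term rs = if (rsum rs ≡ᵇ suc k) ∧ (wsum 1 rs ≡ᵇ suc n)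
                then nat (bellCoeff (suc n) rs) * mono 1 rs
                else 0#

    record IsBellInverse (A : ℕ → ℕ → Carrier) : Set ℓ where
      field
        A00   : A 0 0 ≈ 1#
        An0   : ∀ n → A (suc n) 0 ≈ 0#
        lower : ∀ n k → n ℕ.< k → A n k ≈ 0#
        inv   : ∀ n k → sumFromTo k n (λ j → A n j * B j k) ≈ δ n k

    L : (ℕ → ℕ → Carrier) → ℕ → ℕ → Carrier
    L A n k = sumFromTo k n (λ j → sign j * A n j * B j k)

-- Read as matrices, the signed Lah polynomials are L = A D B, where D is the diagonal matrix of
-- signs (-1)^j. Since A and B are lower triangular and A B = I, also B A = I (a one-sided inverse
-- of a triangular matrix is two-sided), so L L = A D (B A) D B = A D² B = A B = I.
module Submission where

open import Defs
open import Level using (Level)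
open import Data.Nat using (ℕ; _≤_)
open import Data.Product using (Σ)
open import Algebra.Bundles using (CommutativeRing)
open import Algebra.Morphism.Structures using (module RingMorphisms)

open import Data.Nat as ℕ using (zero; suc; _<_; _∸_; _<ᵇ_)
import Data.Nat.Properties as ℕₚ
open import Data.Fin as Fin using (Fin; toℕ; fromℕ; fromℕ<; punchIn)
import Data.Fin.Properties as Finₚ
open import Data.Fin.Induction using (<-wellFounded)
open import Data.Bool using (true)
open import Data.List using (map; applyUpTo; upTo)
open import Data.Product using (∃; _,_)
open import Data.Vec.Functional using (Vector)
open import Function using (_∘_; id)
open import Induction.WellFounded using (Acc; acc)
open import Relation.Binary using (Setoid; tri<; tri≈; tri>)
open import Relation.Binary.PropositionalEquality as ≡ using (_≡_; _≢_)
open import Relation.Nullary using (yes; no; contradiction)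
import Relation.Binary.Reasoning.Setoid as SetoidReasoning

module _ {c ℓ} (R : CommutativeRing c ℓ) where
  open CommutativeRing R
  open import Algebra.Properties.Semiring.Sum semiring
  open import Algebra.Properties.AbelianGroup +-abelianGroup using (∙-cancelʳ)
  open import Algebra.Properties.CommutativeSemigroup *-commutativeSemigroup using (interchange; x∙yz≈y∙xz)
  open import Algebra.Properties.Ring ring using (-1*x≈-x; -‿involutive)
  module ≈-Reasoning = SetoidReasoning setoid

  private variable
    n N : ℕ

  *-cancelˡ-unit : ∀ {a u x y} → a * u ≈ 1# → u * x ≈ u * y → x ≈ y
  *-cancelˡ-unit {a} {u} {x} {y} au≈1 ux≈uy = begin
    x             ≈⟨ *-identityˡ x ⟨
    1# * x        ≈⟨ *-congʳ au≈1 ⟨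
    (a * u) * x   ≈⟨ *-assoc a u x ⟩
    a * (u * x)   ≈⟨ *-congˡ ux≈uy ⟩
    a * (u * y)   ≈⟨ *-assoc a u y ⟨
    (a * u) * y   ≈⟨ *-congʳ au≈1 ⟩
    1# * y        ≈⟨ *-identityˡ y ⟩
    y             ∎
    where open ≈-Reasoning

  sign²≈1 : ∀ j → sign R j * sign R j ≈ 1#
  sign²≈1 zero    = *-identityˡ 1#
  sign²≈1 (suc j) = begin
    (- 1# * sign R j) * (- 1# * sign R j)   ≈⟨ interchange (- 1#) (sign R j) (- 1#) (sign R j) ⟩
    (- 1# * - 1#) * (sign R j * sign R j)   ≈⟨ *-cong (trans (-1*x≈-x (- 1#)) (-‿involutive 1#)) (sign²≈1 j) ⟩
    1# * 1#                                 ≈⟨ *-identityˡ 1# ⟩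
    1#                                      ∎
    where open ≈-Reasoning

  δ-refl : ∀ a → δ R a a ≈ 1#
  δ-refl zero    = refl
  δ-refl (suc a) = δ-refl a

  δ-≢ : ∀ {a b} → a ≢ b → δ R a b ≈ 0#
  δ-≢ {zero}  {zero}  a≢b = contradiction ≡.refl a≢b
  δ-≢ {zero}  {suc b} _   = refl
  δ-≢ {suc a} {zero}  _   = refl
  δ-≢ {suc a} {suc b} a≢b = δ-≢ (a≢b ∘ ≡.cong suc)

  sum-zero : ∀ n {f : Vector Carrier n} → (∀ j → f j ≈ 0#) → sum f ≈ 0#
  sum-zero n f≈0 = trans (sum-cong-≋ f≈0) (sum-replicate-zero n)

  sum-single : (i : Fin n) (f : Vector Carrier n) → (∀ j → j ≢ i → f j ≈ 0#) → sum f ≈ f i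
  sum-single {suc _} i f vanishes = begin
    sum f                        ≈⟨ sum-remove {i = i} f ⟩
    f i + sum (f ∘ punchIn i)    ≈⟨ +-congˡ (sum-zero _ (λ j → vanishes _ (Finₚ.punchInᵢ≢i i j))) ⟩
    f i + 0#                     ≈⟨ +-identityʳ (f i) ⟩
    f i                          ∎
    where open ≈-Reasoning

  sum-cancel : (i : Fin n) (f g : Vector Carrier n) →
               (∀ j → j ≢ i → f j ≈ g j) → sum f ≈ sum g → f i ≈ g i
  sum-cancel {suc _} i f g agree sum-f≈sum-g = ∙-cancelʳ (sum (f ∘ punchIn i)) (f i) (g i) (begin
    f i + sum (f ∘ punchIn i)    ≈⟨ sum-remove {i = i} f ⟨
    sum f                        ≈⟨ sum-f≈sum-g ⟩
    sum g                        ≈⟨ sum-remove {i = i} g ⟩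
    g i + sum (g ∘ punchIn i)    ≈⟨ +-congˡ (sum-cong-≋ (λ j → agree _ (Finₚ.punchInᵢ≢i i j))) ⟨
    g i + sum (f ∘ punchIn i)    ∎)
    where open ≈-Reasoning

  sumBelow : ℕ → (ℕ → Carrier) → Carrier
  sumBelow m f = ∑[ t < m ] f (toℕ t)

  sumBelow-+ : ∀ a b (f : ℕ → Carrier) →
               sumBelow (a ℕ.+ b) f ≈ sumBelow a f + sumBelow b (λ t → f (a ℕ.+ t))
  sumBelow-+ zero    b f = sym (+-identityˡ _)
  sumBelow-+ (suc a) b f = trans (+-congˡ (sumBelow-+ a b (f ∘ suc))) (sym (+-assoc _ _ _))

  sumBelow-≡ : ∀ {a b} (f : ℕ → Carrier) → a ≡ b → sumBelow a f ≈ sumBelow b f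
  sumBelow-≡ f a≡b = reflexive (≡.cong (λ m → sumBelow m f) a≡b)

  sumBelow-pad : ∀ {m N} (f : ℕ → Carrier) → m ≤ N → (∀ {j} → m ≤ j → f j ≈ 0#) →
                 sumBelow m f ≈ sumBelow N f
  sumBelow-pad {m} {N} f m≤N vanishes = begin
    sumBelow m f                                          ≈⟨ +-identityʳ _ ⟨
    sumBelow m f + 0#                                     ≈⟨ +-congˡ (sum-zero (N ∸ m) (λ t → vanishes (ℕₚ.m≤m+n m _))) ⟨
    sumBelow m f + sumBelow (N ∸ m) (λ t → f (m ℕ.+ t))  ≈⟨ sumBelow-+ m (N ∸ m) f ⟨
    sumBelow (m ℕ.+ (N ∸ m)) f                            ≈⟨ sumBelow-≡ f (ℕₚ.m+[n∸m]≡n m≤N) ⟩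
    sumBelow N f                                          ∎
    where open ≈-Reasoning

  sumBelow-shift : ∀ {k m} (f : ℕ → Carrier) → k ≤ m → (∀ {j} → j < k → f j ≈ 0#) →
                   sumBelow (m ∸ k) (λ t → f (k ℕ.+ t)) ≈ sumBelow m f
  sumBelow-shift {k} {m} f k≤m vanishes = begin
    sumBelow (m ∸ k) (λ t → f (k ℕ.+ t))                 ≈⟨ +-identityˡ _ ⟨
    0# + sumBelow (m ∸ k) (λ t → f (k ℕ.+ t))            ≈⟨ +-congʳ (sum-zero k (λ t → vanishes (Finₚ.toℕ<n t))) ⟨
    sumBelow k f + sumBelow (m ∸ k) (λ t → f (k ℕ.+ t))  ≈⟨ sumBelow-+ k (m ∸ k) f ⟨
    sumBelow (k ℕ.+ (m ∸ k)) f                           ≈⟨ sumBelow-≡ f (ℕₚ.m+[n∸m]≡n k≤m) ⟩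
    sumBelow m f                                         ∎
    where open ≈-Reasoning

  sumL-map-applyUpTo : ∀ m (g : ℕ → Carrier) (h : ℕ → ℕ) →
                       sumL R (map g (applyUpTo h m)) ≈ sumBelow m (g ∘ h)
  sumL-map-applyUpTo zero    g h = refl
  sumL-map-applyUpTo (suc m) g h = +-congˡ (sumL-map-applyUpTo m g (h ∘ suc))

  sumFromTo-empty : ∀ {k n} (f : ℕ → Carrier) → n < k → sumFromTo R k n f ≈ 0#
  sumFromTo-empty {k} f n<k =
    reflexive (≡.cong (λ m → sumL R (map (λ t → f (k ℕ.+ t)) (upTo m))) (ℕₚ.m≤n⇒m∸n≡0 n<k))

  sumFromTo≈sumBelow : ∀ {k n N} (f : ℕ → Carrier) → n < N →
                       (∀ {j} → j < k → f j ≈ 0#) → (∀ {j} → n < j → f j ≈ 0#) →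
                       sumFromTo R k n f ≈ sumBelow N f
  sumFromTo≈sumBelow {k} {n} {N} f n<N below above with k ℕ.≤? n
  ... | yes k≤n = begin
    sumFromTo R k n f                         ≈⟨ sumL-map-applyUpTo (suc n ∸ k) (λ t → f (k ℕ.+ t)) id ⟩
    sumBelow (suc n ∸ k) (λ t → f (k ℕ.+ t))  ≈⟨ sumBelow-shift f (ℕₚ.m≤n⇒m≤1+n k≤n) below ⟩
    sumBelow (suc n) f                        ≈⟨ sumBelow-pad f n<N above ⟩
    sumBelow N f                              ∎
    where open ≈-Reasoning
  ... | no k≰n = trans (sumFromTo-empty f (ℕₚ.≰⇒> k≰n)) (sym (sum-zero N (vanishes ∘ toℕ)))
    where
    vanishes : ∀ j → f j ≈ 0#
    vanishes j with j ℕ.≤? n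
    ... | yes j≤n = below (ℕₚ.≤-<-trans j≤n (ℕₚ.≰⇒> k≰n))
    ... | no j≰n  = above (ℕₚ.≰⇒> j≰n)

  Matrix : ℕ → Set c
  Matrix N = Fin N → Fin N → Carrier

  infix  4 _≋_
  infixl 7 _⊗_

  _≋_ : Matrix N → Matrix N → Set ℓ
  M ≋ P = ∀ i j → M i j ≈ P i j

  ≋-setoid : ℕ → Setoid c ℓ
  ≋-setoid N = record
    { Carrier       = Matrix N
    ; _≈_           = _≋_
    ; isEquivalence = record
      { refl  = λ i j → refl
      ; sym   = λ M≋P i j → sym (M≋P i j)
      ; trans = λ M≋P P≋Q i j → trans (M≋P i j) (P≋Q i j)
      }
    }

  module ≋-Reasoning {N} = SetoidReasoning (≋-setoid N)

  _⊗_ : Matrix N → Matrix N → Matrix N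
  (M ⊗ P) i j = sum (λ k → M i k * P k j)

  𝟙 : Matrix N
  𝟙 i j = δ R (toℕ i) (toℕ j)

  LowerTriangular : Matrix N → Set ℓ
  LowerTriangular M = ∀ i j → i Fin.< j → M i j ≈ 0#

  columnScale : Vector Carrier N → Matrix N → Matrix N
  columnScale s M i j = s j * M i j

  𝟙-offDiagonal : ∀ {i j : Fin N} → i ≢ j → 𝟙 i j ≈ 0#
  𝟙-offDiagonal i≢j = δ-≢ (i≢j ∘ Finₚ.toℕ-injective)

  ⊗-cong : ∀ {M M′ P P′ : Matrix N} → M ≋ M′ → P ≋ P′ → M ⊗ P ≋ M′ ⊗ P′
  ⊗-cong M≋M′ P≋P′ i j = sum-cong-≋ (λ k → *-cong (M≋M′ i k) (P≋P′ k j))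

  ⊗-assoc : (M P Q : Matrix N) → (M ⊗ P) ⊗ Q ≋ M ⊗ (P ⊗ Q)
  ⊗-assoc {N} M P Q i j = begin
    sum {N} (λ k → sum {N} (λ l → M i l * P l k) * Q k j)
      ≈⟨ sum-cong-≋ (λ k → *-distribʳ-sum (Q k j) (λ l → M i l * P l k)) ⟩
    sum {N} (λ k → sum {N} (λ l → M i l * P l k * Q k j))
      ≈⟨ ∑-comm (λ k l → M i l * P l k * Q k j) ⟩
    sum {N} (λ l → sum {N} (λ k → M i l * P l k * Q k j))
      ≈⟨ sum-cong-≋ (λ l → sum-cong-≋ (λ k → *-assoc (M i l) (P l k) (Q k j))) ⟩
    sum {N} (λ l → sum {N} (λ k → M i l * (P l k * Q k j)))
      ≈⟨ sum-cong-≋ (λ l → *-distribˡ-sum (M i l) (λ k → P l k * Q k j)) ⟨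
    sum {N} (λ l → M i l * sum {N} (λ k → P l k * Q k j))
      ∎
    where open ≈-Reasoning

  ⊗-identityˡ : (M : Matrix N) → 𝟙 ⊗ M ≋ M
  ⊗-identityˡ M i j = begin
    sum (λ k → 𝟙 i k * M k j)   ≈⟨ sum-single i _ (λ k k≢i → trans (*-congʳ (𝟙-offDiagonal (k≢i ∘ ≡.sym))) (zeroˡ _)) ⟩
    𝟙 i i * M i j               ≈⟨ *-congʳ (δ-refl (toℕ i)) ⟩
    1# * M i j                  ≈⟨ *-identityˡ _ ⟩
    M i j                       ∎
    where open ≈-Reasoning

  ⊗-identityʳ : (M : Matrix N) → M ⊗ 𝟙 ≋ M
  ⊗-identityʳ M i j = begin
    sum (λ k → M i k * 𝟙 k j)   ≈⟨ sum-single j _ (λ k k≢j → trans (*-congˡ (𝟙-offDiagonal k≢j)) (zeroʳ _)) ⟩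
    M i j * 𝟙 j j               ≈⟨ *-congˡ (δ-refl (toℕ j)) ⟩
    M i j * 1#                  ≈⟨ *-identityʳ _ ⟩
    M i j                       ∎
    where open ≈-Reasoning

  ⊗-cancel-middle : ∀ {P Q : Matrix N} (M T : Matrix N) → P ⊗ Q ≋ 𝟙 → (M ⊗ P) ⊗ (Q ⊗ T) ≋ M ⊗ T
  ⊗-cancel-middle {P = P} {Q} M T PQ≋𝟙 = begin
    (M ⊗ P) ⊗ (Q ⊗ T)   ≈⟨ ⊗-assoc M P (Q ⊗ T) ⟩
    M ⊗ (P ⊗ (Q ⊗ T))   ≈⟨ ⊗-cong {M = M} (λ _ _ → refl) (⊗-assoc P Q T) ⟨
    M ⊗ ((P ⊗ Q) ⊗ T)   ≈⟨ ⊗-cong {M = M} (λ _ _ → refl) (⊗-cong PQ≋𝟙 (λ _ _ → refl)) ⟩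
    M ⊗ (𝟙 ⊗ T)         ≈⟨ ⊗-cong {M = M} (λ _ _ → refl) (⊗-identityˡ T) ⟩
    M ⊗ T               ∎
    where open ≋-Reasoning

  ⊗-columnScale : (s : Vector Carrier N) (M P : Matrix N) → M ⊗ columnScale s P ≋ columnScale s (M ⊗ P)
  ⊗-columnScale {N} s M P i j = begin
    sum {N} (λ k → M i k * (s j * P k j))   ≈⟨ sum-cong-≋ (λ k → x∙yz≈y∙xz (M i k) (s j) (P k j)) ⟩
    sum {N} (λ k → s j * (M i k * P k j))   ≈⟨ *-distribˡ-sum (s j) (λ k → M i k * P k j) ⟨
    s j * sum {N} (λ k → M i k * P k j)     ∎
    where open ≈-Reasoning

  columnScale-involutive : (s : Vector Carrier N) → (∀ j → s j * s j ≈ 1#) →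
                           (M : Matrix N) → columnScale s (columnScale s M) ≋ M
  columnScale-involutive s s²≈1 M i j =
    trans (sym (*-assoc _ _ _)) (trans (*-congʳ (s²≈1 j)) (*-identityˡ _))

  ⊗-diagonal : ∀ {M P : Matrix N} → LowerTriangular M → LowerTriangular P → ∀ i → (M ⊗ P) i i ≈ M i i * P i i
  ⊗-diagonal {M = M} {P} M-lower P-lower i = sum-single i (λ k → M i k * P k i) offDiagonal
    where
    offDiagonal : ∀ k → k ≢ i → M i k * P k i ≈ 0#
    offDiagonal k k≢i with Finₚ.<-cmp k i
    ... | tri< k<i _ _ = trans (*-congˡ (P-lower k i k<i)) (zeroʳ _)
    ... | tri≈ _ k≡i _ = contradiction k≡i k≢i
    ... | tri> _ _ i<k = trans (*-congʳ (M-lower i k i<k)) (zeroˡ _)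

  -- Forward substitution: row i of X is recovered from row i of A ⊗ X and the rows above it.
  ⊗-cancelˡ : ∀ {A X Y : Matrix N} → LowerTriangular A → (∀ i → ∃ λ a → a * A i i ≈ 1#) →
              A ⊗ X ≋ A ⊗ Y → X ≋ Y
  ⊗-cancelˡ {A = A} {X} {Y} A-lower A-unitDiagonal AX≋AY i = rows i (<-wellFounded i)
    where
    rows : ∀ i → Acc Fin._<_ i → ∀ j → X i j ≈ Y i j
    rows i (acc above) j with A-unitDiagonal i
    ... | a , aAᵢᵢ≈1 = *-cancelˡ-unit aAᵢᵢ≈1
      (sum-cancel i (λ k → A i k * X k j) (λ k → A i k * Y k j) offDiagonal (AX≋AY i j))
      where
      offDiagonal : ∀ k → k ≢ i → A i k * X k j ≈ A i k * Y k j
      offDiagonal k k≢i with Finₚ.<-cmp k i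
      ... | tri< k<i _ _ = *-congˡ (rows k (above k<i) j)
      ... | tri≈ _ k≡i _ = contradiction k≡i k≢i
      ... | tri> _ _ i<k = trans (*-congʳ Aᵢₖ≈0) (trans (zeroˡ _) (sym (trans (*-congʳ Aᵢₖ≈0) (zeroˡ _))))
        where Aᵢₖ≈0 = A-lower i k i<k

  inverse-diagonal : ∀ {A B : Matrix N} → LowerTriangular A → LowerTriangular B →
                     A ⊗ B ≋ 𝟙 → ∀ i → B i i * A i i ≈ 1#
  inverse-diagonal {A = A} {B} A-lower B-lower AB≋𝟙 i = begin
    B i i * A i i   ≈⟨ *-comm _ _ ⟩
    A i i * B i i   ≈⟨ ⊗-diagonal A-lower B-lower i ⟨
    (A ⊗ B) i i     ≈⟨ AB≋𝟙 i i ⟩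
    𝟙 i i           ≈⟨ δ-refl (toℕ i) ⟩
    1#              ∎
    where open ≈-Reasoning

  lowerTriangular-inverseˡ : ∀ {A B : Matrix N} → LowerTriangular A → LowerTriangular B →
                             A ⊗ B ≋ 𝟙 → B ⊗ A ≋ 𝟙
  lowerTriangular-inverseˡ {A = A} {B} A-lower B-lower AB≋𝟙 =
    ⊗-cancelˡ A-lower (λ i → B i i , inverse-diagonal A-lower B-lower AB≋𝟙 i) (begin
      A ⊗ (B ⊗ A)   ≈⟨ ⊗-assoc A B A ⟨
      A ⊗ B ⊗ A     ≈⟨ ⊗-cong AB≋𝟙 (λ _ _ → refl) ⟩
      𝟙 ⊗ A         ≈⟨ ⊗-identityˡ A ⟩
      A             ≈⟨ ⊗-identityʳ A ⟨
      A ⊗ 𝟙         ∎)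
    where open ≋-Reasoning

  columnScale-⊗-involutive : ∀ {A B : Matrix N} (s : Vector Carrier N) →
                             LowerTriangular A → LowerTriangular B → A ⊗ B ≋ 𝟙 →
                             (∀ j → s j * s j ≈ 1#) →
                             (columnScale s A ⊗ B) ⊗ (columnScale s A ⊗ B) ≋ 𝟙
  columnScale-⊗-involutive {A = A} {B} s A-lower B-lower AB≋𝟙 s²≈1 = begin
    (columnScale s A ⊗ B) ⊗ (columnScale s A ⊗ B)
      ≈⟨ ⊗-cong (⊗-cong AD≋sA (λ _ _ → refl)) (⊗-cong AD≋sA (λ _ _ → refl)) ⟨
    (A ⊗ D ⊗ B) ⊗ (A ⊗ D ⊗ B)
      ≈⟨ ⊗-cong {M = A ⊗ D ⊗ B} (λ _ _ → refl) (⊗-assoc A D B) ⟩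
    (A ⊗ D ⊗ B) ⊗ (A ⊗ (D ⊗ B))
      ≈⟨ ⊗-cancel-middle (A ⊗ D) (D ⊗ B) (lowerTriangular-inverseˡ A-lower B-lower AB≋𝟙) ⟩
    (A ⊗ D) ⊗ (D ⊗ B)
      ≈⟨ ⊗-cancel-middle A B DD≋𝟙 ⟩
    A ⊗ B
      ≈⟨ AB≋𝟙 ⟩
    𝟙 ∎
    where
    open ≋-Reasoning
    D : Matrix _
    D = columnScale s 𝟙

    AD≋sA : A ⊗ D ≋ columnScale s A
    AD≋sA i j = trans (⊗-columnScale s A 𝟙 i j) (*-congˡ (⊗-identityʳ A i j))

    DD≋𝟙 : D ⊗ D ≋ 𝟙
    DD≋𝟙 i j = trans (⊗-columnScale s D 𝟙 i j)
      (trans (*-congˡ (⊗-identityʳ D i j)) (columnScale-involutive s s²≈1 𝟙 i j))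

  LowerTriangularFamily : (ℕ → ℕ → Carrier) → Set ℓ
  LowerTriangularFamily F = ∀ a b → a < b → F a b ≈ 0#

  restrict : (ℕ → ℕ → Carrier) → Matrix N
  restrict F i j = F (toℕ i) (toℕ j)

  restrict-lowerTriangular : ∀ {F} → LowerTriangularFamily F → LowerTriangular {N} (restrict F)
  restrict-lowerTriangular F-lower i j = F-lower (toℕ i) (toℕ j)

  sumFromTo≈⊗ : ∀ {F G} → LowerTriangularFamily F → LowerTriangularFamily G → (i j : Fin N) →
                sumFromTo R (toℕ j) (toℕ i) (λ m → F (toℕ i) m * G m (toℕ j)) ≈ (restrict F ⊗ restrict G) i j
  sumFromTo≈⊗ F-lower G-lower i j =
    sumFromTo≈sumBelow _ (Finₚ.toℕ<n i)
      (λ m<j → trans (*-congˡ (G-lower _ _ m<j)) (zeroʳ _))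
      (λ i<m → trans (*-congʳ (F-lower _ _ i<m)) (zeroˡ _))

  module Lah (X : ℕ → Carrier) {A : ℕ → ℕ → Carrier} (isInverse : Bell.IsBellInverse R X A) where
    open Bell R X using (B; L)
    open Bell.IsBellInverse isInverse using (lower; inv)

    B-lowerTriangular : LowerTriangularFamily B
    B-lowerTriangular zero    (suc k) _   = refl
    B-lowerTriangular (suc j) (suc k) j<k with suc j <ᵇ suc k | ℕₚ.<⇒<ᵇ j<k
    ... | true | _ = refl

    L-lowerTriangular : LowerTriangularFamily (L A)
    L-lowerTriangular a b a<b = sumFromTo-empty (λ j → sign R j * A a j * B j b) a<b

    signedA-lowerTriangular : LowerTriangularFamily (λ a j → sign R j * A a j)
    signedA-lowerTriangular a j a<j = trans (*-congˡ (lower a j a<j)) (zeroʳ _)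

    restrict-A⊗B : restrict A ⊗ restrict B ≋ 𝟙 {N}
    restrict-A⊗B i j = trans (sym (sumFromTo≈⊗ lower B-lowerTriangular i j)) (inv (toℕ i) (toℕ j))

    restrict-L : restrict (L A) ≋ columnScale (sign R ∘ toℕ) (restrict A) ⊗ restrict {N} B
    restrict-L = sumFromTo≈⊗ signedA-lowerTriangular B-lowerTriangular

    restrict-L⊗L : restrict (L A) ⊗ restrict (L A) ≋ 𝟙 {N}
    restrict-L⊗L = begin
      restrict (L A) ⊗ restrict (L A)
        ≈⟨ ⊗-cong restrict-L restrict-L ⟩
      sA ⊗ restrict B ⊗ (sA ⊗ restrict B)
        ≈⟨ columnScale-⊗-involutive _ (restrict-lowerTriangular lower)
             (restrict-lowerTriangular B-lowerTriangular) restrict-A⊗B (sign²≈1 ∘ toℕ) ⟩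
      𝟙 ∎
      where
      open ≋-Reasoning
      sA = columnScale (sign R ∘ toℕ) (restrict A)

    L²≈δ : ∀ {n k} → k ≤ n → sumFromTo R k n (λ j → L A n j * L A j k) ≈ δ R n k
    L²≈δ {n} {k} k≤n = ≡.subst₂ (λ a b → sumFromTo R b a (λ j → L A a j * L A j b) ≈ δ R a b)
      (Finₚ.toℕ-fromℕ n) (Finₚ.toℕ-fromℕ< k<1+n)
      (trans (sumFromTo≈⊗ L-lowerTriangular L-lowerTriangular i j) (restrict-L⊗L i j))
      where
      k<1+n = ℕ.s≤s k≤n
      i = fromℕ n
      j = fromℕ< k<1+n

proposition5p17 : ∀ {c ℓ c′ ℓ′ : Level}
    (K : CommutativeRing c ℓ) → IsField K → CharZero K →
    (R : CommutativeRing c′ ℓ′) →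
    (φ : CommutativeRing.Carrier K → CommutativeRing.Carrier R) →
    RingMorphisms.IsRingHomomorphism (CommutativeRing.rawRing K) (CommutativeRing.rawRing R) φ →
    (X : ℕ → CommutativeRing.Carrier R) →
    Σ (CommutativeRing.Carrier R) (λ y → CommutativeRing._≈_ R (CommutativeRing._*_ R (X 1) y) (CommutativeRing.1# R)) →
    (A : ℕ → ℕ → CommutativeRing.Carrier R) →
    Bell.IsBellInverse R X A →
    (n k : ℕ) → 1 ≤ k → k ≤ n →
    CommutativeRing._≈_ R (sumFromTo R k n (λ j → CommutativeRing._*_ R (Bell.L R X A n j) (Bell.L R X A j k))) (δ R n k)
proposition5p17 _ _ _ R _ _ X _ _ isInverse _ _ _ k≤n = Lah.L²≈δ R X isInverse k≤n
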